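{- Any connected graph $G$ has $\mathrm{rc}(G) \leq 3f(G) - 1$.
   Context: $\mathrm{rc}(G)$ is the rainbow connection number (minimum number of edge colors so that every pair of vertices is joined by a path with pairwise distinct edge colors) and $f(G)$ is the forest number (number of vertices in a largest induced forest of $G$). -}

module Defs where

open import Data.Nat using (ℕ; zero; suc; _≤_; _<_; _*_; _∸_)
open import Data.Bool using (Bool; true; false; T)
open import Data.Fin using (Fin)
open import Data.Fin.Subset using (Subset; _∈_; ∣_∣)
open import Data.List using (List; []; _∷_; length)
open import Data.List.Relation.Unary.Unique.Propositional using (Unique)
open import Data.List.Relation.Unary.All using (All)
open import Data.Product using (Σ; _×_; ∃; ∃-syntax)
open import Relation.Nullary using (¬_)
open import Relation.Binary.PropositionalEquality using (_≡_)

record Graph (n : ℕ) : Set where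
  field
    adj    : Fin n → Fin n → Bool
    sym    : ∀ u v → adj u v ≡ adj v u
    irrefl : ∀ u → adj u u ≡ false

  Adj : Fin n → Fin n → Set
  Adj u v = T (adj u v)

open Graph public

module _ {n : ℕ} (G : Graph n) where

  data Walk : Fin n → Fin n → Set where
    []  : ∀ {u} → Walk u u
    _∷_ : ∀ {u v w} → Adj G u v → Walk v w → Walk u w

  len : ∀ {u w} → Walk u w → ℕ
  len []      = 0
  len (_ ∷ p) = suc (len p)

  verts : ∀ {u w} → Walk u w → List (Fin n)
  verts {u} []      = u ∷ []
  verts {u} (_ ∷ p) = u ∷ verts p

  IsPath : ∀ {u w} → Walk u w → Set
  IsPath p = Unique (verts p)

  Connected : Set
  Connected = ∀ u v → Walk u v

  record EdgeColouring (k : ℕ) : Set where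
    field
      col    : ∀ u v → Adj G u v → Fin k
      colSym : ∀ u v (e : Adj G u v) (e' : Adj G v u) → col u v e ≡ col v u e'

  open EdgeColouring public

  colours : ∀ {k} → EdgeColouring k → ∀ {u w} → Walk u w → List (Fin k)
  colours c []             = []
  colours c (_∷_ {u} {v} e p) = col c u v e ∷ colours c p

  IsRainbowPath : ∀ {k} → EdgeColouring k → ∀ {u w} → Walk u w → Set
  IsRainbowPath c p = IsPath p × Unique (colours c p)

  IsRainbowColouring : ∀ {k} → EdgeColouring k → Set
  IsRainbowColouring c = ∀ u v → Σ (Walk u v) (IsRainbowPath c)

  IsRainbowConnectionNumber : ℕ → Set
  IsRainbowConnectionNumber r =
    Σ (EdgeColouring r) IsRainbowColouring ×
    (∀ k → Σ (EdgeColouring k) IsRainbowColouring → r ≤ k)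

  -- a cycle: an edge u–v closed up by a path from v back to u with at
  -- least two edges (so at least three distinct vertices)
  record Cycle : Set where
    constructor cycle
    field
      {u v} : Fin n
      edge    : Adj G u v
      back    : Walk v u
      backPath : IsPath back
      long     : 2 ≤ len back

  open Cycle public

  InducesForest : Subset n → Set
  InducesForest S = ¬ (Σ Cycle λ C → All (_∈ S) (verts (back C)))

  IsForestNumber : ℕ → Set
  IsForestNumber f =
    (∃[ S ] (InducesForest S × ∣ S ∣ ≡ f)) ×
    (∀ S → InducesForest S → ∣ S ∣ ≤ f)

module Submission where

-- Let S be a maximum induced forest.  Adding a vertex x ∉ S to S creates no
-- cycle unless x has two distinct neighbours in S, so by maximality every
-- vertex outside S has two distinct neighbours a(x) ≠ b(x) in S.
--
-- Such an S is in particular dominating, and then the distance from any set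
-- W ⊆ S to S ∖ W is at most 3.  Starting from W = {ρ} and repeatedly adding
-- a shortest bridge from W to S ∖ W, we collect a list E of at most
-- 3(|S| − 1) edges along which every vertex of S is joined to ρ.
--
-- Colour the i-th edge of E with colour 2 + i, the edges x a(x) (x ∉ S) not
-- in E with colour 0, and all remaining edges with colour 1.  For vertices
-- u, v the walk u → a(u) → (along E) → b(v) → v, shortened to a path, is
-- rainbow: each of its edges can be recovered from its colour.  Hence
-- rc(G) ≤ |E| + 2 ≤ 3 f(G) − 1; the empty graph is treated separately.

open import Defs hiding (sym)
open import Data.Nat using (ℕ; zero; suc; _≤_; _<_; _+_; _*_; _∸_; z≤n; s≤s)
open import Data.Nat.Properties
  using (≤-trans; ≤-refl; ≤-reflexive; <⇒≱; m≤m+n; +-suc; *-suc; +-monoˡ-≤; +-monoʳ-≤; *-monoʳ-≤; ∸-monoˡ-≤; module ≤-Reasoning)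
open import Data.Bool using (Bool; true; false; T; if_then_else_)
open import Data.Fin using (Fin; zero; suc)
open import Data.Fin.Properties using (_≟_; any?)
open import Data.Fin.Subset using (Subset; _∈_; _∉_; _⊆_; ∣_∣; ⁅_⁆; _∪_)
open import Data.Fin.Subset.Properties
  using (_∈?_; x∈⁅x⁆; x∈⁅y⁆⇒x≡y; x∈p∪q⁻; x∈p∪q⁺; p⊆q⇒∣p∣≤∣q∣; p⊂q⇒∣p∣<∣q∣; ∣⁅x⁆∣≡1)
open import Data.List using (List; []; _∷_; _++_; length; lookup; findIndex)
open import Data.List.Properties using (length-++)
open import Data.List.Relation.Unary.Any using (Any; here; there)
import Data.List.Relation.Unary.Any as Any
open import Data.List.Relation.Unary.Any.Properties using (++⁺ˡ; ++⁺ʳ)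
open import Data.List.Relation.Unary.All using (All; []; _∷_)
import Data.List.Relation.Unary.All as All
open import Data.List.Relation.Unary.All.Properties.Core using (¬Any⇒All¬)
open import Data.List.Relation.Unary.AllPairs using ([]; _∷_)
open import Data.List.Relation.Unary.Unique.Propositional using (Unique)
open import Data.List.Membership.Propositional using () renaming (_∈_ to _∈ₗ_)
open import Data.Maybe using (Maybe; just; nothing)
import Data.Maybe as Maybe
open import Data.Product using (Σ; Σ-syntax; _×_; _,_; proj₁; proj₂)
open import Data.Sum using (_⊎_; inj₁; inj₂)
import Data.Sum as Sum
open import Data.Empty using (⊥-elim)
open import Data.Unit using (⊤; tt)
open import Function using (_∘_)
open import Function.Bundles using (_⇔_; mk⇔)
open import Relation.Nullary using (¬_; Dec; yes; no; does)
open import Relation.Nullary.Decidable using (_×-dec_; _⊎-dec_; ¬?; T?; map′; does-⇔; dec-true; dec-false; decidable-stable)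
open import Relation.Unary using (Pred; Decidable)
open import Relation.Binary.PropositionalEquality using (_≡_; _≢_; refl; sym; trans; cong; cong₂; subst)

-- The colour of an edge of E is the position
-- of its first occurrence in E; these facts say that this position exists,
-- points at the edge, and depends only on the predicate searched for.

module _ {a p q} {A : Set a} {P : Pred A p} {Q : Pred A q} where

  findIndex-cong : (P? : Decidable P) (Q? : Decidable Q) → (∀ x → P x ⇔ Q x) →
                   ∀ xs → findIndex P? xs ≡ findIndex Q? xs
  findIndex-cong P? Q? P⇔Q [] = refl
  findIndex-cong P? Q? P⇔Q (x ∷ xs) =
    cong₂ (λ b i → if b then just zero else Maybe.map suc i)
          (does-⇔ (P⇔Q x) (P? x) (Q? x)) (findIndex-cong P? Q? P⇔Q xs)

module _ {a p} {A : Set a} {P : Pred A p} (P? : Decidable P) where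

  findIndex-just : ∀ {xs} → Any P xs → Σ[ i ∈ Fin (length xs) ] findIndex P? xs ≡ just i × P (lookup xs i)
  findIndex-just {x ∷ xs} any with P? x
  ... | yes px = zero , refl , px
  findIndex-just {x ∷ xs} (here px) | no ¬px = ⊥-elim (¬px px)
  findIndex-just {x ∷ xs} (there any) | no _ =
    let i , found , pi = findIndex-just any in suc i , cong (Maybe.map suc) found , pi

  findIndex-nothing : ∀ {xs} → ¬ Any P xs → findIndex P? xs ≡ nothing
  findIndex-nothing {[]} _ = refl
  findIndex-nothing {x ∷ xs} none with P? x
  ... | yes px = ⊥-elim (none (here px))
  ... | no _ = cong (Maybe.map suc) (findIndex-nothing (none ∘ there))

data Joins {a} {A : Set a} (x y : A) : A × A → Set a where
  forward  : Joins x y (x , y)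
  backward : Joins x y (y , x)

module _ {a} {A : Set a} where

  Joins-swap : ∀ {x y : A} {q} → Joins x y q → Joins y x q
  Joins-swap forward  = backward
  Joins-swap backward = forward

  Joins-same : ∀ {x y x′ y′ : A} {q} → Joins x y q → Joins x′ y′ q → x ≡ x′ ⊎ x ≡ y′
  Joins-same forward  forward  = inj₁ refl
  Joins-same forward  backward = inj₂ refl
  Joins-same backward forward  = inj₂ refl
  Joins-same backward backward = inj₁ refl

joins? : ∀ {n} (x y : Fin n) → Decidable (Joins x y)
joins? x y (c , d) = map′ from to ((x ≟ c ×-dec y ≟ d) ⊎-dec (x ≟ d ×-dec y ≟ c))
  where
  from : (x ≡ c × y ≡ d) ⊎ (x ≡ d × y ≡ c) → Joins x y (c , d)
  from (inj₁ (refl , refl)) = forward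
  from (inj₂ (refl , refl)) = backward
  to : Joins x y (c , d) → (x ≡ c × y ≡ d) ⊎ (x ≡ d × y ≡ c)
  to forward  = inj₁ (refl , refl)
  to backward = inj₂ (refl , refl)

EdgeList : ℕ → Set
EdgeList n = List (Fin n × Fin n)

InE : ∀ {n} → EdgeList n → Fin n → Fin n → Set
InE E x y = Any (Joins x y) E

InE-sym : ∀ {n} {E : EdgeList n} {x y} → InE E x y → InE E y x
InE-sym = Any.map Joins-swap

insert-grows : ∀ {n} {x : Fin n} {p : Subset n} → x ∉ p → ∣ p ∣ < ∣ ⁅ x ⁆ ∪ p ∣
insert-grows {x = x} x∉p = p⊂q⇒∣p∣<∣q∣ ((λ y∈p → x∈p∪q⁺ (inj₂ y∈p)) , x , x∈p∪q⁺ (inj₁ (x∈⁅x⁆ x)) , x∉p)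

∈-insert-other : ∀ {n} {x y : Fin n} {p : Subset n} → y ∈ ⁅ x ⁆ ∪ p → y ≢ x → y ∈ p
∈-insert-other {x = x} {p = p} y∈ y≢x with x∈p∪q⁻ ⁅ x ⁆ p y∈
... | inj₁ y∈⁅x⁆ = ⊥-elim (y≢x (x∈⁅y⁆⇒x≡y x y∈⁅x⁆))
... | inj₂ y∈p   = y∈p

module _ {n : ℕ} (G : Graph n) where

  adj-sym : ∀ {u v} → Adj G u v → Adj G v u
  adj-sym {u} {v} = subst T (Graph.sym G u v)

  adj⇒≢ : ∀ {u v} → Adj G u v → u ≢ v
  adj⇒≢ {u} e refl = subst T (Graph.irrefl G u) e

  infixr 5 _++ʷ_
  _++ʷ_ : ∀ {u v w} → Walk G u v → Walk G v w → Walk G u w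
  []      ++ʷ q = q
  (e ∷ p) ++ʷ q = e ∷ (p ++ʷ q)

  reverse : ∀ {u v} → Walk G u v → Walk G v u
  reverse []      = []
  reverse (e ∷ p) = reverse p ++ʷ (adj-sym e ∷ [])

  EdgesIn : (Fin n → Fin n → Set) → ∀ {u v} → Walk G u v → Set
  EdgesIn P []                = ⊤
  EdgesIn P (_∷_ {u} {v} _ p) = P u v × EdgesIn P p

  EdgesIn-map : ∀ {P Q : Fin n → Fin n → Set} → (∀ {x y} → P x y → Q x y) →
                ∀ {u v} (p : Walk G u v) → EdgesIn P p → EdgesIn Q p
  EdgesIn-map f []      _          = tt
  EdgesIn-map f (_ ∷ p) (Pe , Pp) = f Pe , EdgesIn-map f p Pp

  EdgesIn-++ : ∀ {P u v w} (p : Walk G u v) (q : Walk G v w) → EdgesIn P p → EdgesIn P q → EdgesIn P (p ++ʷ q)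
  EdgesIn-++ []      q _          Pq = Pq
  EdgesIn-++ (_ ∷ p) q (Pe , Pp) Pq = Pe , EdgesIn-++ p q Pp Pq

  EdgesIn-reverse : ∀ {P : Fin n → Fin n → Set} → (∀ {x y} → P x y → P y x) →
                    ∀ {u v} (p : Walk G u v) → EdgesIn P p → EdgesIn P (reverse p)
  EdgesIn-reverse P-sym []      _          = tt
  EdgesIn-reverse P-sym (_ ∷ p) (Pe , Pp) = EdgesIn-++ (reverse p) _ (EdgesIn-reverse P-sym p Pp) (P-sym Pe , tt)

  WalkWith : (Fin n → Fin n → Set) → Fin n → Fin n → Set
  WalkWith P x y = Σ[ p ∈ Walk G x y ] EdgesIn P p

  infixr 5 _⊕_
  _⊕_ : ∀ {P x y z} → WalkWith P x y → WalkWith P y z → WalkWith P x z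
  (p , Pp) ⊕ (q , Pq) = p ++ʷ q , EdgesIn-++ p q Pp Pq

  with-map : ∀ {P Q : Fin n → Fin n → Set} → (∀ {x y} → P x y → Q x y) → ∀ {x y} → WalkWith P x y → WalkWith Q x y
  with-map f (p , Pp) = p , EdgesIn-map f p Pp

  with-reverse : ∀ {P : Fin n → Fin n → Set} → (∀ {x y} → P x y → P y x) → ∀ {x y} → WalkWith P x y → WalkWith P y x
  with-reverse P-sym (p , Pp) = reverse p , EdgesIn-reverse P-sym p Pp

  start∈ : ∀ {u v} (p : Walk G u v) → u ∈ₗ verts G p
  start∈ []      = here refl
  start∈ (_ ∷ p) = here refl

  end∈ : ∀ {u v} (p : Walk G u v) → v ∈ₗ verts G p
  end∈ []      = here refl
  end∈ (_ ∷ p) = there (end∈ p)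

  PathWith : (Fin n → Fin n → Set) → Fin n → Fin n → Set
  PathWith P u v = Σ[ p ∈ Walk G u v ] IsPath G p × EdgesIn P p

  suffix : ∀ {P x y v} (q : Walk G y v) → IsPath G q → EdgesIn P q → x ∈ₗ verts G q → PathWith P x v
  suffix []      q-path Pq        (here refl)  = [] , q-path , Pq
  suffix (e ∷ q) q-path Pq        (here refl)  = e ∷ q , q-path , Pq
  suffix (e ∷ q) (_ ∷ q-path) (_ , Pq) (there x∈q) = suffix q q-path Pq x∈q

  shortcut : ∀ {P u v} (p : Walk G u v) → EdgesIn P p → PathWith P u v
  shortcut []      _ = [] , [] ∷ [] , tt
  shortcut {u = u} (e ∷ p) (Pe , Pp) with shortcut p Pp
  ... | q , q-path , Pq with Any.any? (u ≟_) (verts G q)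
  ...   | yes u∈q = suffix q q-path Pq u∈q
  ...   | no  u∉q = e ∷ q , ¬Any⇒All¬ _ u∉q ∷ q-path , Pe , Pq

  TwoNeighbours : (Fin n → Set) → Fin n → Set
  TwoNeighbours P x = Σ[ y ∈ Fin n ] Σ[ z ∈ Fin n ] y ≢ z × Adj G x y × Adj G x z × P y × P z

  twoNeighbours? : ∀ {P : Fin n → Set} → Decidable P → ∀ x → Dec (TwoNeighbours P x)
  twoNeighbours? P? x = any? λ y → any? λ z →
    ¬? (y ≟ z) ×-dec T? (adj G x y) ×-dec T? (adj G x z) ×-dec P? y ×-dec P? z

  second-vertex : ∀ {a b} (p : Walk G a b) → IsPath G p → 2 ≤ len G p →
                  Σ[ y ∈ Fin n ] Adj G a y × y ∈ₗ verts G p × y ≢ b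
  second-vertex (_ ∷ []) _ (s≤s ())
  second-vertex (e ∷ (_ ∷ q)) (_ ∷ y∉q ∷ _) _ = _ , e , there (here refl) , All.lookup y∉q (end∈ q)

  penultimate-vertex : ∀ {a b} (p : Walk G a b) → IsPath G p → 2 ≤ len G p →
                       Σ[ y ∈ Fin n ] Adj G y b × y ∈ₗ verts G p × y ≢ a
  penultimate-vertex (_ ∷ []) _ (s≤s ())
  penultimate-vertex (e ∷ (e′ ∷ [])) (a∉ ∷ _) _ =
    _ , e′ , there (here refl) , λ y≡a → All.lookup a∉ (here refl) (sym y≡a)
  penultimate-vertex (e ∷ (e′ ∷ (e″ ∷ q))) (a∉ ∷ rest) _ =
    let y , yb , y∈ , _ = penultimate-vertex (e′ ∷ e″ ∷ q) rest (s≤s (s≤s z≤n))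
    in  y , yb , there y∈ , λ y≡a → All.lookup a∉ y∈ (sym y≡a)

  inner-vertex : ∀ {a b x} (p : Walk G a b) → IsPath G p → x ∈ₗ verts G p → x ≢ a → x ≢ b →
                 TwoNeighbours (_∈ₗ verts G p) x
  inner-vertex []      _ (here refl) x≢a _ = ⊥-elim (x≢a refl)
  inner-vertex (e ∷ q) _ (here refl) x≢a _ = ⊥-elim (x≢a refl)
  inner-vertex {x = x} (_∷_ {v = c} e q) (_ ∷ q-path) (there x∈q) x≢a x≢b with x ≟ c
  inner-vertex (e ∷ [])       _         (there _) _ x≢b | yes refl = ⊥-elim (x≢b refl)
  inner-vertex (e ∷ (e′ ∷ q)) (a∉ ∷ _) (there _) _ _   | yes refl =
    _ , _ , All.lookup a∉ (there (start∈ q)) , adj-sym e , e′ , here refl , there (there (start∈ q))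
  ... | no x≢c =
    let y , z , y≢z , xy , xz , y∈ , z∈ = inner-vertex q q-path x∈q x≢c x≢b
    in  y , z , y≢z , xy , xz , there y∈ , there z∈

  cycle-neighbours : (C : Cycle G) → ∀ {x} → x ∈ₗ verts G (back C) → TwoNeighbours (_∈ₗ verts G (back C)) x
  cycle-neighbours (cycle {u} {v} uv closing closing-path long) {x} x∈C with x ≟ v | x ≟ u
  ... | yes refl | _ =
    let z , vz , z∈ , z≢u = second-vertex closing closing-path long
    in  u , z , (λ u≡z → z≢u (sym u≡z)) , adj-sym uv , vz , end∈ closing , z∈
  ... | no _ | yes refl =
    let z , zu , z∈ , z≢v = penultimate-vertex closing closing-path long
    in  v , z , (λ v≡z → z≢v (sym v≡z)) , uv , adj-sym zu , start∈ closing , z∈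
  ... | no x≢v | no x≢u = inner-vertex closing closing-path x∈C x≢v x≢u

  -- a cycle inside ⁅ x ⁆ ∪ S through x gives x two distinct neighbours in S;
  -- a cycle avoiding x lies in S
  extend-forest : ∀ {S x} → InducesForest G S → ¬ TwoNeighbours (_∈ S) x → InducesForest G (⁅ x ⁆ ∪ S)
  extend-forest {S} {x} forest lonely (C , C⊆) with Any.any? (x ≟_) (verts G (back C))
  ... | yes x∈C =
    let y , z , y≢z , xy , xz , y∈C , z∈C = cycle-neighbours C x∈C
    in  lonely (y , z , y≢z , xy , xz ,
                ∈-insert-other (All.lookup C⊆ y∈C) (λ y≡x → adj⇒≢ xy (sym y≡x)) ,
                ∈-insert-other (All.lookup C⊆ z∈C) (λ z≡x → adj⇒≢ xz (sym z≡x)))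
  ... | no x∉C =
    forest (C , All.tabulate λ y∈C → ∈-insert-other (All.lookup C⊆ y∈C) λ { refl → x∉C y∈C })

  maximum-forest-twoNeighbours : ∀ {S} → InducesForest G S → (∀ S′ → InducesForest G S′ → ∣ S′ ∣ ≤ ∣ S ∣) →
                                 ∀ x → x ∉ S → TwoNeighbours (_∈ S) x
  maximum-forest-twoNeighbours {S} forest maximum x x∉S =
    decidable-stable (twoNeighbours? (_∈? S) x)
      λ lonely → <⇒≱ (insert-grows x∉S) (maximum _ (extend-forest forest lonely))

  -- Rainbow paths by decoding: a path is rainbow as soon as every edge can be
  -- recovered, up to orientation, from its colour.

  Decoded : ∀ {k} → EdgeColouring G k → (Fin k → Fin n × Fin n) → Fin n → Fin n → Set
  Decoded c decode x y = ∀ e → Joins x y (decode (col c x y e))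

  module _ {k} (c : EdgeColouring G k) (decode : Fin k → Fin n × Fin n) where

    fresh-colour : ∀ {γ u w y v} (q : Walk G y v) → EdgesIn (Decoded c decode) q →
                   All (u ≢_) (verts G q) → Joins u w (decode γ) → All (γ ≢_) (colours G c q)
    fresh-colour []      _          _              _ = []
    fresh-colour (e ∷ q) (de , dq) (u≢x ∷ u∉q) j =
      (λ γ≡ → Sum.[ u≢x , (λ u≡x′ → All.lookup u∉q (start∈ q) u≡x′) ]
                   (Joins-same j (subst (λ γ′ → Joins _ _ (decode γ′)) (sym γ≡) (de e))))
      ∷ fresh-colour q dq u∉q j

    rainbow-by-decoding : ∀ {u v} (p : Walk G u v) → IsPath G p → EdgesIn (Decoded c decode) p →
                          Unique (colours G c p)
    rainbow-by-decoding []      _                _          = []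
    rainbow-by-decoding (e ∷ q) (u∉q ∷ q-path) (de , dq) =
      fresh-colour q dq u∉q (de e) ∷ rainbow-by-decoding q q-path dq

  WalkAlong : EdgeList n → Fin n → Fin n → Set
  WalkAlong E = WalkWith (InE E)

  edgeList : ∀ {u v} → Walk G u v → EdgeList n
  edgeList []                = []
  edgeList (_∷_ {u} {v} _ p) = (u , v) ∷ edgeList p

  length-edgeList : ∀ {u v} (p : Walk G u v) → length (edgeList p) ≡ len G p
  length-edgeList []      = refl
  length-edgeList (_ ∷ p) = cong suc (length-edgeList p)

  along-own-edges : ∀ {u v} (p : Walk G u v) → EdgesIn (InE (edgeList p)) p
  along-own-edges []      = tt
  along-own-edges (_ ∷ p) = here forward , EdgesIn-map there p (along-own-edges p)

  Dominating : Subset n → Set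
  Dominating S = ∀ x → x ∉ S → Σ[ y ∈ Fin n ] Adj G x y × y ∈ S

  twoNeighbours⇒dominating : ∀ {S} → (∀ x → x ∉ S → TwoNeighbours (_∈ S) x) → Dominating S
  twoNeighbours⇒dominating two x x∉S = let y , _ , _ , xy , _ , y∈S , _ = two x x∉S in y , xy , y∈S

  dominating-nonempty : ∀ {S} → Dominating S → Fin n → Σ[ x ∈ Fin n ] x ∈ S
  dominating-nonempty {S} dominating x with x ∈? S
  ... | yes x∈S = x , x∈S
  ... | no  x∉S = let y , _ , y∈S = dominating x x∉S in y , y∈S

  record Bridge (S W : Subset n) : Set where
    constructor bridge
    field
      {source target} : Fin n
      source∈W : source ∈ W
      target∈S : target ∈ S
      target∉W : target ∉ W
      walk     : Walk G source target
      short    : len G walk ≤ 3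

  -- If S is dominating, any walk from W to S ∖ W can be replaced by a bridge:
  -- follow the walk while it stays in W; past its exit y–z, either y or z is
  -- in S, or z has a neighbour t ∈ S, and if t ∈ W we restart at t–z.
  module _ {S : Subset n} (dominating : Dominating S) {W : Subset n} where
    mutual
      bridge-from : ∀ {x s} → x ∈ W → s ∈ S → s ∉ W → Walk G x s → Bridge S W
      bridge-from x∈W s∈S s∉W [] = ⊥-elim (s∉W x∈W)
      bridge-from x∈W s∈S s∉W (_∷_ {v = y} e q) with y ∈? W
      ... | yes y∈W = bridge-from y∈W s∈S s∉W q
      ... | no  y∉W = bridge-exit x∈W e y∉W s∈S s∉W q

      bridge-exit : ∀ {w y s} → w ∈ W → Adj G w y → y ∉ W → s ∈ S → s ∉ W → Walk G y s → Bridge S W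
      bridge-exit w∈W e y∉W s∈S s∉W [] = bridge w∈W s∈S y∉W (e ∷ []) (s≤s z≤n)
      bridge-exit {y = y} w∈W e y∉W s∈S s∉W (_∷_ {v = z} e′ q) with y ∈? S
      ... | yes y∈S = bridge w∈W y∈S y∉W (e ∷ []) (s≤s z≤n)
      ... | no  _ with z ∈? W
      ...   | yes z∈W = bridge-from z∈W s∈S s∉W q
      ...   | no  z∉W with z ∈? S
      ...     | yes z∈S = bridge w∈W z∈S z∉W (e ∷ e′ ∷ []) (s≤s (s≤s z≤n))
      ...     | no  z∉S with dominating z z∉S
      ...       | t , e″ , t∈S with t ∈? W
      ...         | no  t∉W = bridge w∈W t∈S t∉W (e ∷ e′ ∷ e″ ∷ []) ≤-refl
      ...         | yes t∈W = bridge-exit t∈W (adj-sym e″) z∉W s∈S s∉W q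

  -- E joins every vertex of W to the root ρ, with |E| ≤ 3 (|W| − 1)
  record Connector (ρ : Fin n) (W : Subset n) : Set where
    field
      edges : EdgeList n
      reach : ∀ x → x ∈ W → WalkAlong edges x ρ
      size  : 3 + length edges ≤ 3 * ∣ W ∣

  open Connector public

  singleton-connector : ∀ ρ → Connector ρ ⁅ ρ ⁆
  singleton-connector ρ = record
    { edges = []
    ; reach = λ x x∈⁅ρ⁆ → subst (λ y → WalkAlong [] y ρ) (sym (x∈⁅y⁆⇒x≡y ρ x∈⁅ρ⁆)) ([] , tt)
    ; size  = ≤-reflexive (cong (3 *_) (sym (∣⁅x⁆∣≡1 ρ)))
    }

  extend-connector : ∀ {ρ S W} (C : Connector ρ W) (β : Bridge S W) → Connector ρ (⁅ Bridge.target β ⁆ ∪ W)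
  extend-connector {ρ} {S} {W} C (bridge {s} {t} s∈W _ t∉W w short) = record
    { edges = edgeList w ++ edges C
    ; reach = reach′
    ; size  = size′
    }
    where
    E′ : EdgeList n
    E′ = edgeList w ++ edges C

    old : ∀ {x y} → InE (edges C) x y → InE E′ x y
    old = ++⁺ʳ (edgeList w)

    reach′ : ∀ x → x ∈ ⁅ t ⁆ ∪ W → WalkAlong E′ x ρ
    reach′ x x∈ with x∈p∪q⁻ ⁅ t ⁆ W x∈
    ... | inj₂ x∈W = with-map old (reach C x x∈W)
    ... | inj₁ x∈⁅t⁆ rewrite x∈⁅y⁆⇒x≡y t x∈⁅t⁆ =
      with-reverse InE-sym (with-map ++⁺ˡ (w , along-own-edges w)) ⊕ with-map old (reach C s s∈W)

    open ≤-Reasoning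
    size′ : 3 + length E′ ≤ 3 * ∣ ⁅ t ⁆ ∪ W ∣
    size′ = begin
      3 + length E′                  ≡⟨ cong (3 +_) (trans (length-++ (edgeList w))
                                                        (cong (_+ length (edges C)) (length-edgeList w))) ⟩
      3 + (len G w + length (edges C)) ≤⟨ +-monoʳ-≤ 3 (+-monoˡ-≤ (length (edges C)) short) ⟩
      3 + (3 + length (edges C))     ≤⟨ +-monoʳ-≤ 3 (size C) ⟩
      3 + 3 * ∣ W ∣                   ≡⟨ sym (*-suc 3 ∣ W ∣) ⟩
      3 * suc ∣ W ∣                   ≤⟨ *-monoʳ-≤ 3 (insert-grows t∉W) ⟩
      3 * ∣ ⁅ t ⁆ ∪ W ∣               ∎

  -- grow a connector of W ⊆ S by bridges until it covers S; each bridge adds a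
  -- vertex of S, so ∣ S ∣ ∸ ∣ W ∣ ≤ fuel steps suffice
  grow : ∀ {ρ S} → Connected G → Dominating S → (fuel : ℕ) → ∀ {W} → ρ ∈ W → W ⊆ S →
         ∣ S ∣ ≤ fuel + ∣ W ∣ → Connector ρ W → Connector ρ S
  grow {ρ} {S} conn dominating fuel {W} ρ∈W W⊆S bound C
    with any? (λ s → s ∈? S ×-dec ¬? (s ∈? W))
  ... | no none = record
    { edges = edges C
    ; reach = λ x x∈S → reach C x (decidable-stable (x ∈? W) λ x∉W → none (x , x∈S , x∉W))
    ; size  = ≤-trans (size C) (*-monoʳ-≤ 3 (p⊆q⇒∣p∣≤∣q∣ W⊆S))
    }
  ... | yes (s , s∈S , s∉W) = next fuel bound
    where
    β : Bridge S W
    β = bridge-from dominating ρ∈W s∈S s∉W (conn ρ s)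

    t : Fin n
    t = Bridge.target β

    W′ : Subset n
    W′ = ⁅ t ⁆ ∪ W

    W′⊆S : W′ ⊆ S
    W′⊆S x∈ with x∈p∪q⁻ ⁅ t ⁆ W x∈
    ... | inj₁ x∈⁅t⁆ = subst (_∈ S) (sym (x∈⁅y⁆⇒x≡y t x∈⁅t⁆)) (Bridge.target∈S β)
    ... | inj₂ x∈W   = W⊆S x∈W

    grows : ∣ W ∣ < ∣ W′ ∣
    grows = insert-grows (Bridge.target∉W β)

    -- without fuel the bridge would make W′ ⊆ S larger than S
    next : ∀ k → ∣ S ∣ ≤ k + ∣ W ∣ → Connector ρ S
    next zero    bound = ⊥-elim (<⇒≱ grows (≤-trans (p⊆q⇒∣p∣≤∣q∣ W′⊆S) bound))
    next (suc k) bound =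
      grow conn dominating k (x∈p∪q⁺ (inj₂ ρ∈W)) W′⊆S
           (≤-trans bound (≤-trans (≤-reflexive (sym (+-suc k ∣ W ∣))) (+-monoʳ-≤ k grows)))
           (extend-connector C β)

  connector : Connected G → ∀ {S ρ} → Dominating S → ρ ∈ S → Connector ρ S
  connector conn {S} {ρ} dominating ρ∈S =
    grow conn dominating ∣ S ∣ (x∈⁅x⁆ ρ)
         (λ x∈⁅ρ⁆ → subst (_∈ S) (sym (x∈⁅y⁆⇒x≡y ρ x∈⁅ρ⁆)) ρ∈S)
         (m≤m+n ∣ S ∣ ∣ ⁅ ρ ⁆ ∣) (singleton-connector ρ)

  module ConnectorColouring {S : Subset n} (two : ∀ x → x ∉ S → TwoNeighbours (_∈ S) x)
                            {ρ : Fin n} (C : Connector ρ S) where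

    E : EdgeList n
    E = edges C

    chosen : (x : Fin n) → Dec (x ∈ S) → Fin n × Fin n
    chosen x (yes _)   = x , x
    chosen x (no x∉S) = proj₁ (two x x∉S) , proj₁ (proj₂ (two x x∉S))

    a b : Fin n → Fin n
    a x = proj₁ (chosen x (x ∈? S))
    b x = proj₂ (chosen x (x ∈? S))

    chosen-spec : ∀ x → x ∉ S → a x ≢ b x × Adj G x (a x) × Adj G x (b x) × a x ∈ S × b x ∈ S
    chosen-spec x x∉S with x ∈? S
    ... | yes x∈S  = ⊥-elim (x∉S x∈S)
    ... | no  x∉S′ = proj₂ (proj₂ (two x x∉S′))

    Attached : Fin n → Fin n → Set
    Attached x y = (x ∉ S × y ≡ a x) ⊎ (y ∉ S × x ≡ a y)

    attached? : ∀ x y → Dec (Attached x y)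
    attached? x y = (¬? (x ∈? S) ×-dec y ≟ a x) ⊎-dec (¬? (y ∈? S) ×-dec x ≟ a y)

    K : ℕ
    K = 2 + length E

    colourOf : Maybe (Fin (length E)) → Bool → Fin K
    colourOf (just i) _     = suc (suc i)
    colourOf nothing  true  = zero
    colourOf nothing  false = suc zero

    ψ : Fin n → Fin n → Fin K
    ψ x y = colourOf (findIndex (joins? x y) E) (does (attached? x y))

    ψ-sym : ∀ x y → ψ x y ≡ ψ y x
    ψ-sym x y =
      cong₂ colourOf (findIndex-cong (joins? x y) (joins? y x) (λ _ → mk⇔ Joins-swap Joins-swap) E)
                     (does-⇔ (mk⇔ Sum.swap Sum.swap) (attached? x y) (attached? y x))

    colouring : EdgeColouring G K
    colouring = record { col = λ x y _ → ψ x y ; colSym = λ x y _ _ → ψ-sym x y }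

    ψ-onE : ∀ {x y} → InE E x y → Σ[ i ∈ Fin (length E) ] ψ x y ≡ suc (suc i) × Joins x y (lookup E i)
    ψ-onE {x} {y} x–y =
      let i , found , j = findIndex-just (joins? x y) x–y
      in  i , cong (λ m → colourOf m (does (attached? x y))) found , j

    ψ-offE : ∀ {x y} → ¬ InE E x y → ψ x y ≡ colourOf nothing (does (attached? x y))
    ψ-offE {x} {y} off = cong (λ m → colourOf m (does (attached? x y))) (findIndex-nothing (joins? x y) off)

    ψ-attached : ∀ {x y} → ¬ InE E x y → Attached x y → ψ x y ≡ zero
    ψ-attached {x} {y} off att = trans (ψ-offE off) (cong (colourOf nothing) (dec-true (attached? x y) att))

    ψ-detached : ∀ {x y} → ¬ InE E x y → ¬ Attached x y → ψ x y ≡ suc zero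
    ψ-detached {x} {y} off det = trans (ψ-offE off) (cong (colourOf nothing) (dec-false (attached? x y) det))

    -- on the rainbow path from u to v, colour 0 is the edge u a(u), colour 1
    -- the edge b(v) v, and colour 2 + i the i-th edge of E
    decode : Fin n → Fin n → Fin K → Fin n × Fin n
    decode u v zero          = u , a u
    decode u v (suc zero)    = v , b v
    decode u v (suc (suc i)) = lookup E i

    Decodes : Fin n → Fin n → Fin n → Fin n → Set
    Decodes u v x y = Joins x y (decode u v (ψ x y))

    decodes-by : ∀ {u v x y γ} → ψ x y ≡ γ → Joins x y (decode u v γ) → Decodes u v x y
    decodes-by {u} {v} {x} {y} ψ≡γ = subst (λ γ → Joins x y (decode u v γ)) (sym ψ≡γ)

    onE-decodes : ∀ {u v x y} → InE E x y → Decodes u v x y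
    onE-decodes x–y = let _ , ψ≡ , j = ψ-onE x–y in decodes-by ψ≡ j

    exit-decodes : ∀ {u} v → u ∉ S → Decodes u v u (a u)
    exit-decodes {u} v u∉S with Any.any? (joins? u (a u)) E
    ... | yes onE = onE-decodes onE
    ... | no  offE = decodes-by (ψ-attached offE (inj₁ (u∉S , refl))) forward

    entry-decodes : ∀ u {v} → v ∉ S → Decodes u v (b v) v
    entry-decodes u {v} v∉S with Any.any? (joins? (b v) v) E
    ... | yes onE = onE-decodes onE
    ... | no  offE = decodes-by (ψ-detached offE detached) backward
      where
      -- b v ∈ S, and b v ≠ a v
      detached : ¬ Attached (b v) v
      detached (inj₁ (bv∉S , _))    = let _ , _ , _ , _ , b∈S = chosen-spec v v∉S in bv∉S b∈S
      detached (inj₂ (_ , bv≡av)) = let a≢b , _ = chosen-spec v v∉S in a≢b (sym bv≡av)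

    exit : ∀ u v → Dec (u ∈ S) → Σ[ u′ ∈ Fin n ] u′ ∈ S × WalkWith (Decodes u v) u u′
    exit u v (yes u∈S) = u , u∈S , [] , tt
    exit u v (no  u∉S) = let _ , ua , _ , a∈S , _ = chosen-spec u u∉S
                         in  a u , a∈S , ua ∷ [] , exit-decodes v u∉S , tt

    entry : ∀ u v → Dec (v ∈ S) → Σ[ v′ ∈ Fin n ] v′ ∈ S × WalkWith (Decodes u v) v′ v
    entry u v (yes v∈S) = v , v∈S , [] , tt
    entry u v (no  v∉S) = let _ , _ , vb , _ , b∈S = chosen-spec v v∉S
                          in  b v , b∈S , adj-sym vb ∷ [] , entry-decodes u v∉S , tt

    rainbow-path : ∀ u v → Σ (Walk G u v) (IsRainbowPath G colouring)
    rainbow-path u v =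
      let u′ , u′∈S , start  = exit u v (u ∈? S)
          v′ , v′∈S , finish = entry u v (v ∈? S)
          middle             = with-map onE-decodes (reach C u′ u′∈S ⊕ with-reverse InE-sym (reach C v′ v′∈S))
          w , Dw             = start ⊕ middle ⊕ finish
          p , p-path , Dp    = shortcut w Dw
      in  p , p-path , rainbow-by-decoding colouring (decode u v) p p-path (EdgesIn-map (λ d _ → d) p Dp)

    rainbow-colouring : Σ (EdgeColouring G K) (IsRainbowColouring G)
    rainbow-colouring = colouring , rainbow-path

open ConnectorColouring using (rainbow-colouring)

theorem2 : ∀ {n : ℕ} (G : Graph n) → Connected G →
    ∀ (r f : ℕ) → IsRainbowConnectionNumber G r → IsForestNumber G f →
    r ≤ 3 * f ∸ 1
theorem2 {zero} G _ r f (_ , minimal) _ =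
  ≤-trans (minimal 0 (record { col = λ () ; colSym = λ () } , λ ())) z≤n
theorem2 {suc n} G conn r f (_ , minimal) ((S , forest , ∣S∣≡f) , maximum) =
  begin
    r                     ≤⟨ minimal _ (rainbow-colouring G two C) ⟩
    2 + length (edges C)  ≤⟨ ∸-monoˡ-≤ 1 (size C) ⟩
    3 * ∣ S ∣ ∸ 1          ≡⟨ cong (λ m → 3 * m ∸ 1) ∣S∣≡f ⟩
    3 * f ∸ 1             ∎
  where
  open ≤-Reasoning

  two : ∀ x → x ∉ S → TwoNeighbours G (_∈ S) x
  two = maximum-forest-twoNeighbours G forest λ S′ h → subst (∣ S′ ∣ ≤_) (sym ∣S∣≡f) (maximum S′ h)

  dominating : Dominating G S
  dominating = twoNeighbours⇒dominating G two

  root : Σ[ ρ ∈ Fin (suc n) ] ρ ∈ S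
  root = dominating-nonempty G dominating zero

  C : Connector G (proj₁ root) S
  C = connector G conn dominating (proj₂ root)
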